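{- Let $n\ge 1$, $d\ge 1$, and let $\mathcal A_1,\dots,\mathcal A_d\subset 2^{[n]}$ be pairwise cross-IU (i.e. $\mathcal A_i,\mathcal A_j$ are cross-IU for all $i\ne j$). Then $\sum_{i=1}^d|\mathcal A_i|\le\max\{2^n,\ d\cdot 2^{n-2}\}$.
   Context: Families $\mathcal A,\mathcal B\subset 2^{[n]}$ are cross-IU if for all $A\in\mathcal A$ and $B\in\mathcal B$ we have both $A\cap B\ne\emptyset$ and $A\cup B\ne[n]$. -}

module Defs where

open import Data.Nat using (ℕ; _^_; _∸_; _*_; _⊔_)
open import Data.Fin using (Fin)
open import Data.Fin.Subset using (Subset; _∩_; _∪_; ⊥; ⊤)
open import Data.List using (List; length; map; allFin)
open import Data.Nat.ListAction using (sum)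
open import Data.Product using (_×_)
open import Data.List.Relation.Unary.Unique.Propositional using (Unique)
open import Data.List.Membership.Propositional using (_∈_)
open import Relation.Binary.PropositionalEquality using (_≡_)
open import Relation.Nullary using (¬_)

record Family (n : ℕ) : Set where
  field
    members : List (Subset n)
    unique  : Unique members
open Family public

card : ∀ {n} → Family n → ℕ
card 𝓐 = length (members 𝓐)

CrossIU : ∀ {n} → Family n → Family n → Set
CrossIU {n} 𝓐 𝓑 =
  ∀ {A B : Subset n} → A ∈ members 𝓐 → B ∈ members 𝓑 →
    ¬ (A ∩ B ≡ ⊥) × ¬ (A ∪ B ≡ ⊤)

sumFin : ∀ d → (Fin d → ℕ) → ℕ
sumFin d f = sum (map f (allFin d))

{-# OPTIONS --safe #-}
module Submission where

-- Let multiplicity Z count the families containing Z, and call Y shared if it lies in at least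
-- two of them. Sets from different families are neither disjoint nor jointly covering, so the
-- up-set Up of all Z with Z ∪ Y = [n] for a shared Y, and the down-set Down of all Z with
-- Z ∩ Y = ∅ for a shared Y, contain no member of any family and no complementary pair; hence
-- |Up|, |Down| ≤ 2^(n-1). A shared Y puts ∁ Y into Up ∩ Down, and the Harris–Kleitman inequality
-- 2^n |Up ∩ Down| ≤ |Up| |Down| gives |Shared| ≤ |Up ∩ Down| ≤ |Up| / 2, |Down| / 2, so that
-- |Up ∪ Down| ≥ 3 |Shared| and |Shared| ≤ 2^(n-2). Summing the pointwise bound
-- multiplicity Z + [Z shared] + [Z ∈ Up ∪ Down] ≤ d [Z shared] + 1 over all Z then yields
-- Σ |𝓐ᵢ| ≤ 2^n + (d - 4) |Shared|, which is at most 2^n for d ≤ 4 and at most d 2^(n-2) otherwise.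

open import Defs
open import Data.Bool using (if_then_else_)
import Data.Bool as Bool
open import Data.Fin using (Fin; zero; suc)
open import Data.Fin.Properties using (suc-injective)
open import Data.Fin.Subset using (Subset; _⊆_; _∩_; _∪_; ⊥; ⊤; ∁; inside; outside)
  renaming (_∈_ to _∈ₛ_; _∉_ to _∉ₛ_)
open import Data.Fin.Subset.Properties
  using (s⊆s; out⊆; ⊆-refl; ⊆-antisym; ⊆⊤; ∈⊤; ∉⊥; Empty-unique; x∈p∪q⁺; x∈p∪q⁻; x∈p∩q⁺; x∈p∩q⁻;
         x∈∁p⇒x∉p; x∉p⇒x∈∁p; ∪-inverseˡ; ∩-inverseˡ; anySubset?)
open import Data.List using (List; []; _∷_; length; map; allFin)
open import Data.List.Properties using (map-tabulate; map-cong)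
open import Data.List.Membership.Propositional using (_∈_)
open import Data.List.Relation.Unary.AllPairs using (_∷_)
open import Data.List.Relation.Unary.Any using (any?)
open import Data.List.Relation.Unary.Unique.Propositional using (Unique)
open import Data.List.Relation.Unary.Unique.Propositional.Properties using (Unique[x∷xs]⇒x∉xs)
open import Data.Nat using (ℕ; zero; suc; _+_; _*_; _^_; _∸_; _⊔_; _≤_; _≥_; NonZero; z≤n; s≤s; s≤s⁻¹; _≤?_)
open import Data.Nat.ListAction using (sum)
open import Data.Nat.Properties hiding (_≟_; suc-injective)
open import Algebra.Properties.CommutativeSemigroup +-commutativeSemigroup using (interchange)
open import Data.Nat.Solver using (module +-*-Solver)
open import Data.Product using (_×_; _,_; ∃; proj₁; proj₂; uncurry)
open import Data.Sum using (_⊎_; inj₁; inj₂; map₁)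
open import Data.Vec using ([]; _∷_)
open import Data.Vec.Properties using (≡-dec)
open import Function using (_∘_)
open import Level using (Level)
open import Relation.Binary.Core using (_Preserves_⟶_)
open import Relation.Binary.Definitions using (DecidableEquality)
open import Relation.Binary.PropositionalEquality
open import Relation.Nullary using (¬_; Dec; yes; no; does; contradiction; _×-dec_; _⊎-dec_)
open import Relation.Unary using (Pred; Decidable)

private
  variable
    n : ℕ
    a b : Level
    P : Set a
    Q : Set b

𝟙 : Dec P → ℕ
𝟙 P? = if does P? then 1 else 0

𝟙≤1 : (P? : Dec P) → 𝟙 P? ≤ 1
𝟙≤1 (yes _) = ≤-refl
𝟙≤1 (no _)  = z≤n

𝟙-yes : (P? : Dec P) → P → 𝟙 P? ≡ 1
𝟙-yes (yes _) _ = refl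
𝟙-yes (no ¬p) p = contradiction p ¬p

𝟙-no : (P? : Dec P) → ¬ P → 𝟙 P? ≡ 0
𝟙-no (yes p) ¬p = contradiction p ¬p
𝟙-no (no _)  _  = refl

𝟙-mono : (P? : Dec P) (Q? : Dec Q) → (P → Q) → 𝟙 P? ≤ 𝟙 Q?
𝟙-mono (yes p) Q? P⇒Q = ≤-reflexive (sym (𝟙-yes Q? (P⇒Q p)))
𝟙-mono (no _)  Q? _   = z≤n

𝟙-× : (P? : Dec P) (Q? : Dec Q) → 𝟙 (P? ×-dec Q?) ≡ 𝟙 P? * 𝟙 Q?
𝟙-× (yes _) (yes _) = refl
𝟙-× (yes _) (no _)  = refl
𝟙-× (no _)  _       = refl

𝟙-⊎-× : (P? : Dec P) (Q? : Dec Q) → 𝟙 (P? ⊎-dec Q?) + 𝟙 (P? ×-dec Q?) ≡ 𝟙 P? + 𝟙 Q?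
𝟙-⊎-× (yes _) (yes _) = refl
𝟙-⊎-× (yes _) (no _)  = refl
𝟙-⊎-× (no _)  (yes _) = refl
𝟙-⊎-× (no _)  (no _)  = refl

𝟙-⊎-disjoint : (P? : Dec P) (Q? : Dec Q) → ¬ (P × Q) → 𝟙 (P? ⊎-dec Q?) ≡ 𝟙 P? + 𝟙 Q?
𝟙-⊎-disjoint P? Q? ¬P×Q = begin
  𝟙 (P? ⊎-dec Q?)                   ≡⟨ +-identityʳ _ ⟨
  𝟙 (P? ⊎-dec Q?) + 0               ≡⟨ cong (𝟙 (P? ⊎-dec Q?) +_) (𝟙-no (P? ×-dec Q?) ¬P×Q) ⟨
  𝟙 (P? ⊎-dec Q?) + 𝟙 (P? ×-dec Q?) ≡⟨ 𝟙-⊎-× P? Q? ⟩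
  𝟙 P? + 𝟙 Q?                       ∎
  where open ≡-Reasoning

𝟙-disjoint-≤ : (P? : Dec P) (Q? : Dec Q) → ¬ (P × Q) → 𝟙 P? + 𝟙 Q? ≤ 1
𝟙-disjoint-≤ P? Q? ¬P×Q = subst (_≤ 1) (𝟙-⊎-disjoint P? Q? ¬P×Q) (𝟙≤1 (P? ⊎-dec Q?))

∑ : ∀ n → (Subset n → ℕ) → ℕ
∑ zero    f = f []
∑ (suc n) f = ∑ n (f ∘ (inside ∷_)) + ∑ n (f ∘ (outside ∷_))

∑-cong : ∀ n {f g : Subset n → ℕ} → (∀ Z → f Z ≡ g Z) → ∑ n f ≡ ∑ n g
∑-cong zero    f≡g = f≡g []
∑-cong (suc n) f≡g = cong₂ _+_ (∑-cong n (f≡g ∘ (inside ∷_))) (∑-cong n (f≡g ∘ (outside ∷_)))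

∑-mono-≤ : ∀ n {f g : Subset n → ℕ} → (∀ Z → f Z ≤ g Z) → ∑ n f ≤ ∑ n g
∑-mono-≤ zero    f≤g = f≤g []
∑-mono-≤ (suc n) f≤g = +-mono-≤ (∑-mono-≤ n (f≤g ∘ (inside ∷_))) (∑-mono-≤ n (f≤g ∘ (outside ∷_)))

∑-distrib-+ : ∀ n (f g : Subset n → ℕ) → ∑ n (λ Z → f Z + g Z) ≡ ∑ n f + ∑ n g
∑-distrib-+ zero    f g = refl
∑-distrib-+ (suc n) f g = trans
  (cong₂ _+_ (∑-distrib-+ n (f ∘ (inside ∷_)) (g ∘ (inside ∷_))) (∑-distrib-+ n (f ∘ (outside ∷_)) (g ∘ (outside ∷_))))
  (interchange (∑ n (f ∘ (inside ∷_))) _ _ _)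

∑-distribˡ-* : ∀ n c (f : Subset n → ℕ) → ∑ n (λ Z → c * f Z) ≡ c * ∑ n f
∑-distribˡ-* zero    c f = refl
∑-distribˡ-* (suc n) c f = trans
  (cong₂ _+_ (∑-distribˡ-* n c (f ∘ (inside ∷_))) (∑-distribˡ-* n c (f ∘ (outside ∷_))))
  (sym (*-distribˡ-+ c _ _))

∑-const : ∀ n c → ∑ n (λ _ → c) ≡ 2 ^ n * c
∑-const zero    c = sym (*-identityˡ c)
∑-const (suc n) c = begin
  ∑ n (λ _ → c) + ∑ n (λ _ → c) ≡⟨ cong₂ _+_ (∑-const n c) (∑-const n c) ⟩
  2 ^ n * c + 2 ^ n * c         ≡⟨ cong (2 ^ n * c +_) (+-identityʳ (2 ^ n * c)) ⟨
  2 * (2 ^ n * c)               ≡⟨ *-assoc 2 (2 ^ n) c ⟨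
  2 ^ suc n * c                 ∎
  where open ≡-Reasoning

∑-zero : ∀ n → ∑ n (λ _ → 0) ≡ 0
∑-zero n = trans (∑-const n 0) (*-zeroʳ (2 ^ n))

∑-∁ : ∀ n (f : Subset n → ℕ) → ∑ n (f ∘ ∁) ≡ ∑ n f
∑-∁ zero    f = refl
∑-∁ (suc n) f = trans
  (cong₂ _+_ (∑-∁ n (f ∘ (outside ∷_))) (∑-∁ n (f ∘ (inside ∷_))))
  (+-comm (∑ n (f ∘ (outside ∷_))) _)

∑-antipodal : ∀ n {c} (f : Subset n → ℕ) → (∀ Z → f Z + f (∁ Z) ≤ c) → 2 * ∑ n f ≤ 2 ^ n * c
∑-antipodal n {c} f bound = begin
  2 * ∑ n f                  ≡⟨ cong (∑ n f +_) (+-identityʳ (∑ n f)) ⟩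
  ∑ n f + ∑ n f              ≡⟨ cong (∑ n f +_) (∑-∁ n f) ⟨
  ∑ n f + ∑ n (f ∘ ∁)        ≡⟨ ∑-distrib-+ n f (f ∘ ∁) ⟨
  ∑ n (λ Z → f Z + f (∁ Z))  ≤⟨ ∑-mono-≤ n bound ⟩
  ∑ n (λ _ → c)              ≡⟨ ∑-const n c ⟩
  2 ^ n * c                  ∎
  where open ≤-Reasoning

infix 4 _≟_ _∈?_

_≟_ : DecidableEquality (Subset n)
_≟_ = ≡-dec Bool._≟_

_∈?_ : (Z : Subset n) (xs : List (Subset n)) → Dec (Z ∈ xs)
Z ∈? xs = any? (Z ≟_) xs

-- Both proofs below rely on `does` computing through ≡-dec and any?: the decision of
-- b ∷ Z ≟ b′ ∷ Y is that of (b ≟ b′) ×-dec (Z ≟ Y), and Z ∈? y ∷ ys is (Z ≟ y) ⊎-dec (Z ∈? ys).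
∑-𝟙-≟ : ∀ n (Y : Subset n) → ∑ n (λ Z → 𝟙 (Z ≟ Y)) ≡ 1
∑-𝟙-≟ zero    []            = refl
∑-𝟙-≟ (suc n) (inside ∷ Y)  = cong₂ _+_ (∑-𝟙-≟ n Y) (∑-zero n)
∑-𝟙-≟ (suc n) (outside ∷ Y) = cong₂ _+_ (∑-zero n) (∑-𝟙-≟ n Y)

length≡∑-𝟙-∈ : ∀ n (xs : List (Subset n)) → Unique xs → length xs ≡ ∑ n (λ Z → 𝟙 (Z ∈? xs))
length≡∑-𝟙-∈ n []       _ = sym (∑-zero n)
length≡∑-𝟙-∈ n (y ∷ ys) unique@(_ ∷ uniqueʸˢ) = begin
  1 + length ys                                    ≡⟨ cong₂ _+_ (sym (∑-𝟙-≟ n y)) (length≡∑-𝟙-∈ n ys uniqueʸˢ) ⟩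
  ∑ n (λ Z → 𝟙 (Z ≟ y)) + ∑ n (λ Z → 𝟙 (Z ∈? ys))  ≡⟨ ∑-distrib-+ n _ _ ⟨
  ∑ n (λ Z → 𝟙 (Z ≟ y) + 𝟙 (Z ∈? ys))              ≡⟨ ∑-cong n (λ Z → 𝟙-⊎-disjoint (Z ≟ y) (Z ∈? ys) (y∉ys Z)) ⟨
  ∑ n (λ Z → 𝟙 (Z ∈? (y ∷ ys)))                    ∎
  where
  open ≡-Reasoning
  y∉ys : ∀ Z → ¬ (Z ≡ y × Z ∈ ys)
  y∉ys Z (refl , y∈ys) = Unique[x∷xs]⇒x∉xs unique y∈ys

sum-∑-comm : ∀ {A : Set a} n (f : A → Subset n → ℕ) (xs : List A) →
  sum (map (λ x → ∑ n (f x)) xs) ≡ ∑ n (λ Z → sum (map (λ x → f x Z) xs))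
sum-∑-comm n f []       = sym (∑-zero n)
sum-∑-comm n f (x ∷ xs) =
  trans (cong (∑ n (f x) +_) (sum-∑-comm n f xs)) (sym (∑-distrib-+ n _ _))

sumFin-suc : ∀ d (f : Fin (suc d) → ℕ) → sumFin (suc d) f ≡ f zero + sumFin d (f ∘ suc)
sumFin-suc d f = cong (λ xs → f zero + sum xs) (trans (map-tabulate suc f) (sym (map-tabulate (λ i → i) (f ∘ suc))))

sumFin-≤ : ∀ d {f : Fin d → ℕ} {c} → (∀ i → f i ≤ c) → sumFin d f ≤ d * c
sumFin-≤ zero    f≤c = z≤n
sumFin-≤ (suc d) {f} f≤c rewrite sumFin-suc d f = +-mono-≤ (f≤c zero) (sumFin-≤ d (f≤c ∘ suc))

count-witness : ∀ d {P : Pred (Fin d) a} (P? : Decidable P) →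
  1 ≤ sumFin d (λ i → 𝟙 (P? i)) → ∃ P
count-witness (suc d) P? count≥1 rewrite sumFin-suc d (λ i → 𝟙 (P? i)) with P? zero
... | yes p = zero , p
... | no _  = let i , p = count-witness d (P? ∘ suc) count≥1 in suc i , p

count-other-witness : ∀ d {P : Pred (Fin d) a} (P? : Decidable P) →
  2 ≤ sumFin d (λ i → 𝟙 (P? i)) → ∀ k → ∃ λ i → i ≢ k × P i
count-other-witness (suc d) P? count≥2 k rewrite sumFin-suc d (λ i → 𝟙 (P? i)) with k | P? zero
... | zero  | yes _ = let i , p = count-witness d (P? ∘ suc) (s≤s⁻¹ count≥2) in suc i , (λ ()) , p
... | zero  | no _  = let i , p = count-witness d (P? ∘ suc) (≤-trans (n≤1+n 1) count≥2) in suc i , (λ ()) , p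
... | suc _ | yes p = zero , (λ ()) , p
... | suc k | no _  = let i , i≢k , p = count-other-witness d (P? ∘ suc) count≥2 k in suc i , i≢k ∘ suc-injective , p

-- (a₁ + a₀) (b₁ + b₀) - 2 (a₁ b₁ + a₀ b₀) = (a₁ - a₀) (b₀ - b₁) ≥ 0.
chebyshev-two-point : ∀ {a₀ a₁ b₀ b₁} → a₀ ≤ a₁ → b₁ ≤ b₀ →
  2 * (a₁ * b₁ + a₀ * b₀) ≤ (a₁ + a₀) * (b₁ + b₀)
chebyshev-two-point {a₀} {_} {_} {b₁} a₀≤a₁ b₁≤b₀
  with x , refl ← m≤n⇒∃[o]m+o≡n a₀≤a₁ | y , refl ← m≤n⇒∃[o]m+o≡n b₁≤b₀ =
  ≤-trans (m≤m+n _ (x * y)) (≤-reflexive (solve 4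
    (λ a₀ x b₁ y → con 2 :* ((a₀ :+ x) :* b₁ :+ a₀ :* (b₁ :+ y)) :+ x :* y
                := ((a₀ :+ x) :+ a₀) :* (b₁ :+ (b₁ :+ y)))
    refl a₀ x b₁ y))
  where open +-*-Solver

harris-kleitman : ∀ n {f g : Subset n → ℕ} → f Preserves _⊆_ ⟶ _≤_ → g Preserves _⊆_ ⟶ _≥_ →
  2 ^ n * ∑ n (λ Z → f Z * g Z) ≤ ∑ n f * ∑ n g
harris-kleitman zero    _ _ = ≤-reflexive (+-identityʳ _)
harris-kleitman (suc n) {f} {g} f↑ g↓ = begin
  2 ^ suc n * (∑ n (λ Z → f₁ Z * g₁ Z) + ∑ n (λ Z → f₀ Z * g₀ Z))
    ≡⟨ trans (*-assoc 2 (2 ^ n) _) (cong (2 *_) (*-distribˡ-+ (2 ^ n) _ _)) ⟩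
  2 * (2 ^ n * ∑ n (λ Z → f₁ Z * g₁ Z) + 2 ^ n * ∑ n (λ Z → f₀ Z * g₀ Z))
    ≤⟨ *-monoʳ-≤ 2 (+-mono-≤ (harris-kleitman n (f↑ ∘ s⊆s) (g↓ ∘ s⊆s))
                              (harris-kleitman n (f↑ ∘ s⊆s) (g↓ ∘ s⊆s))) ⟩
  2 * (∑ n f₁ * ∑ n g₁ + ∑ n f₀ * ∑ n g₀)
    ≤⟨ chebyshev-two-point (∑-mono-≤ n (λ _ → f↑ (out⊆ ⊆-refl))) (∑-mono-≤ n (λ _ → g↓ (out⊆ ⊆-refl))) ⟩
  (∑ n f₁ + ∑ n f₀) * (∑ n g₁ + ∑ n g₀)
    ∎
  where
  open ≤-Reasoning
  f₁ f₀ g₁ g₀ : Subset n → ℕ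
  f₁ = f ∘ (inside ∷_)
  f₀ = f ∘ (outside ∷_)
  g₁ = g ∘ (inside ∷_)
  g₀ = g ∘ (outside ∷_)

module _ {Z Y : Subset n} where

  ∪≡⊤⇒covers : Z ∪ Y ≡ ⊤ → ∀ x → x ∈ₛ Z ⊎ x ∈ₛ Y
  ∪≡⊤⇒covers Z∪Y≡⊤ x = x∈p∪q⁻ Z Y (subst (x ∈ₛ_) (sym Z∪Y≡⊤) ∈⊤)

  covers⇒∪≡⊤ : (∀ x → x ∈ₛ Z ⊎ x ∈ₛ Y) → Z ∪ Y ≡ ⊤
  covers⇒∪≡⊤ covers = ⊆-antisym ⊆⊤ (λ {x} _ → x∈p∪q⁺ (covers x))

  ∩≡⊥⇒disjoint : Z ∩ Y ≡ ⊥ → ∀ {x} → x ∈ₛ Z → x ∉ₛ Y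
  ∩≡⊥⇒disjoint Z∩Y≡⊥ x∈Z x∈Y = ∉⊥ (subst (_ ∈ₛ_) Z∩Y≡⊥ (x∈p∩q⁺ (x∈Z , x∈Y)))

  disjoint⇒∩≡⊥ : (∀ {x} → x ∈ₛ Z → x ∉ₛ Y) → Z ∩ Y ≡ ⊥
  disjoint⇒∩≡⊥ disjoint = Empty-unique λ (_ , x∈Z∩Y) → uncurry disjoint (x∈p∩q⁻ Z Y x∈Z∩Y)

module _ {Z Y Y′ : Subset n} where

  ∪≡⊤-resolve : Z ∪ Y ≡ ⊤ → ∁ Z ∪ Y′ ≡ ⊤ → Y ∪ Y′ ≡ ⊤
  ∪≡⊤-resolve Z∪Y≡⊤ ∁Z∪Y′≡⊤ = covers⇒∪≡⊤ λ x → resolve (∪≡⊤⇒covers Z∪Y≡⊤ x) (∪≡⊤⇒covers ∁Z∪Y′≡⊤ x)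
    where
    resolve : ∀ {x} → x ∈ₛ Z ⊎ x ∈ₛ Y → x ∈ₛ ∁ Z ⊎ x ∈ₛ Y′ → x ∈ₛ Y ⊎ x ∈ₛ Y′
    resolve (inj₂ x∈Y)  _             = inj₁ x∈Y
    resolve (inj₁ _)    (inj₂ x∈Y′)   = inj₂ x∈Y′
    resolve (inj₁ x∈Z)  (inj₁ x∈∁Z)   = contradiction x∈Z (x∈∁p⇒x∉p x∈∁Z)

  ∩≡⊥-resolve : Z ∩ Y ≡ ⊥ → ∁ Z ∩ Y′ ≡ ⊥ → Y ∩ Y′ ≡ ⊥
  ∩≡⊥-resolve Z∩Y≡⊥ ∁Z∩Y′≡⊥ = disjoint⇒∩≡⊥ λ x∈Y →
    ∩≡⊥⇒disjoint ∁Z∩Y′≡⊥ (x∉p⇒x∈∁p λ x∈Z → ∩≡⊥⇒disjoint Z∩Y≡⊥ x∈Z x∈Y)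

module _ {Z W Y : Subset n} (Z⊆W : Z ⊆ W) where

  ∪≡⊤-monoˡ : Z ∪ Y ≡ ⊤ → W ∪ Y ≡ ⊤
  ∪≡⊤-monoˡ Z∪Y≡⊤ = covers⇒∪≡⊤ λ x → map₁ Z⊆W (∪≡⊤⇒covers Z∪Y≡⊤ x)

  ∩≡⊥-antimonoˡ : W ∩ Y ≡ ⊥ → Z ∩ Y ≡ ⊥
  ∩≡⊥-antimonoˡ W∩Y≡⊥ = disjoint⇒∩≡⊥ λ x∈Z → ∩≡⊥⇒disjoint W∩Y≡⊥ (Z⊆W x∈Z)

2^n≤4*2^[n∸2] : ∀ n → 2 ^ n ≤ 4 * 2 ^ (n ∸ 2)
2^n≤4*2^[n∸2] zero          = s≤s z≤n
2^n≤4*2^[n∸2] (suc zero)    = s≤s (s≤s z≤n)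
2^n≤4*2^[n∸2] (suc (suc n)) = ≤-reflexive (sym (*-assoc 2 2 (2 ^ n)))

n*c≤u*v∧2*v≤n⇒2*c≤u : ∀ {n c u v} .{{_ : NonZero n}} → n * c ≤ u * v → 2 * v ≤ n → 2 * c ≤ u
n*c≤u*v∧2*v≤n⇒2*c≤u {n} {c} {u} {v} nc≤uv 2v≤n = *-cancelʳ-≤ (2 * c) u n (begin
  2 * c * n    ≡⟨ trans (*-assoc 2 c n) (cong (2 *_) (*-comm c n)) ⟩
  2 * (n * c)  ≤⟨ *-monoʳ-≤ 2 nc≤uv ⟩
  2 * (u * v)  ≡⟨ trans (sym (*-assoc 2 u v)) (trans (cong (_* v) (*-comm 2 u)) (*-assoc u 2 v)) ⟩
  u * (2 * v)  ≤⟨ *-monoʳ-≤ u 2v≤n ⟩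
  u * n        ∎)
  where open ≤-Reasoning

t+k*i≤d*i+n⇒t≤n⊔d*q : ∀ k d {t i n q} → t + k * i ≤ d * i + n → i ≤ q → n ≤ k * q → t ≤ n ⊔ d * q
t+k*i≤d*i+n⇒t≤n⊔d*q k d {t} {i} {n} {q} t+ki≤di+n i≤q n≤kq = ≤-trans t≤n+[d∸k]i n+[d∸k]i≤n⊔dq
  where
  open ≤-Reasoning
  t≤n+[d∸k]i : t ≤ n + (d ∸ k) * i
  t≤n+[d∸k]i = +-cancelʳ-≤ (k * i) t _ (begin
    t + k * i                ≤⟨ t+ki≤di+n ⟩
    d * i + n                ≤⟨ +-monoˡ-≤ n (*-monoˡ-≤ i (m≤n+m∸n d k)) ⟩
    (k + (d ∸ k)) * i + n    ≡⟨ solve 4 (λ k e i n → (k :+ e) :* i :+ n := n :+ e :* i :+ k :* i) refl k (d ∸ k) i n ⟩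
    n + (d ∸ k) * i + k * i  ∎)
    where open +-*-Solver
  n+[d∸k]i≤n⊔dq : n + (d ∸ k) * i ≤ n ⊔ d * q
  n+[d∸k]i≤n⊔dq with d ≤? k
  ... | yes d≤k = begin
    n + (d ∸ k) * i      ≡⟨ cong (λ e → n + e * i) (m≤n⇒m∸n≡0 d≤k) ⟩
    n + 0                ≡⟨ +-identityʳ n ⟩
    n                    ≤⟨ m≤m⊔n n (d * q) ⟩
    n ⊔ d * q            ∎
  ... | no d≰k = begin
    n + (d ∸ k) * i      ≤⟨ +-mono-≤ n≤kq (*-monoʳ-≤ (d ∸ k) i≤q) ⟩
    k * q + (d ∸ k) * q  ≡⟨ *-distribʳ-+ q k (d ∸ k) ⟨
    (k + (d ∸ k)) * q    ≡⟨ cong (_* q) (m+[n∸m]≡n (<⇒≤ (≰⇒> d≰k))) ⟩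
    d * q                ≤⟨ m≤n⊔m n (d * q) ⟩
    n ⊔ d * q            ∎

module CrossIUFamilies {n d : ℕ} (𝓐 : Fin d → Family n)
                       (cross : ∀ i j → i ≢ j → CrossIU (𝓐 i) (𝓐 j)) where

  open ≤-Reasoning

  multiplicity : Subset n → ℕ
  multiplicity Z = sumFin d (λ i → 𝟙 (Z ∈? members (𝓐 i)))

  Shared Up Down : Subset n → Set
  Shared Y = 2 ≤ multiplicity Y
  Up   Z = ∃ λ Y → Shared Y × Z ∪ Y ≡ ⊤
  Down Z = ∃ λ Y → Shared Y × Z ∩ Y ≡ ⊥

  shared? : Decidable Shared
  shared? Y = 2 ≤? multiplicity Y

  up? : Decidable Up
  up? Z = anySubset? (λ Y → shared? Y ×-dec (Z ∪ Y ≟ ⊤))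

  down? : Decidable Down
  down? Z = anySubset? (λ Y → shared? Y ×-dec (Z ∩ Y ≟ ⊥))

  multiplicity≤d : ∀ Z → multiplicity Z ≤ d
  multiplicity≤d Z = ≤-trans (sumFin-≤ d (λ i → 𝟙≤1 (Z ∈? members (𝓐 i)))) (≤-reflexive (*-identityʳ d))

  shared⇒member : ∀ {Y} → Shared Y → 1 ≤ multiplicity Y
  shared⇒member = ≤-trans (n≤1+n 1)

  member-shared-cross : ∀ {Z Y} → 1 ≤ multiplicity Z → Shared Y → ¬ (Z ∩ Y ≡ ⊥) × ¬ (Z ∪ Y ≡ ⊤)
  member-shared-cross {Z} {Y} Z-member Y-shared =
    let i , Z∈𝓐ᵢ       = count-witness d (λ i → Z ∈? members (𝓐 i)) Z-member
        j , j≢i , Y∈𝓐ⱼ = count-other-witness d (λ j → Y ∈? members (𝓐 j)) Y-shared i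
    in cross i j (j≢i ∘ sym) Z∈𝓐ᵢ Y∈𝓐ⱼ

  member⇒¬Up⊎Down : ∀ {Z} → 1 ≤ multiplicity Z → ¬ (Up Z ⊎ Down Z)
  member⇒¬Up⊎Down Z-member (inj₁ (_ , Y-shared , Z∪Y≡⊤)) = proj₂ (member-shared-cross Z-member Y-shared) Z∪Y≡⊤
  member⇒¬Up⊎Down Z-member (inj₂ (_ , Y-shared , Z∩Y≡⊥)) = proj₁ (member-shared-cross Z-member Y-shared) Z∩Y≡⊥

  ¬Up×Up∁ : ∀ Z → ¬ (Up Z × Up (∁ Z))
  ¬Up×Up∁ Z ((_ , Y-shared , Z∪Y≡⊤) , (_ , Y′-shared , ∁Z∪Y′≡⊤)) =
    proj₂ (member-shared-cross (shared⇒member Y-shared) Y′-shared) (∪≡⊤-resolve Z∪Y≡⊤ ∁Z∪Y′≡⊤)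

  ¬Down×Down∁ : ∀ Z → ¬ (Down Z × Down (∁ Z))
  ¬Down×Down∁ Z ((_ , Y-shared , Z∩Y≡⊥) , (_ , Y′-shared , ∁Z∩Y′≡⊥)) =
    proj₁ (member-shared-cross (shared⇒member Y-shared) Y′-shared) (∩≡⊥-resolve Z∩Y≡⊥ ∁Z∩Y′≡⊥)

  Up-mono : ∀ {Z W} → Z ⊆ W → Up Z → Up W
  Up-mono Z⊆W (Y , Y-shared , Z∪Y≡⊤) = Y , Y-shared , ∪≡⊤-monoˡ Z⊆W Z∪Y≡⊤

  Down-antimono : ∀ {Z W} → Z ⊆ W → Down W → Down Z
  Down-antimono Z⊆W (Y , Y-shared , W∩Y≡⊥) = Y , Y-shared , ∩≡⊥-antimonoˡ Z⊆W W∩Y≡⊥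

  shared⇒Up∁×Down∁ : ∀ {Y} → Shared Y → Up (∁ Y) × Down (∁ Y)
  shared⇒Up∁×Down∁ {Y} Y-shared = (Y , Y-shared , ∪-inverseˡ Y) , (Y , Y-shared , ∩-inverseˡ Y)

  pointwise-bound : ∀ Z →
    multiplicity Z + 𝟙 (shared? Z) + 𝟙 (up? Z ⊎-dec down? Z) ≤ d * 𝟙 (shared? Z) + 1
  pointwise-bound Z = by-cases (shared? Z) (1 ≤? multiplicity Z)
    where
    e : ℕ
    e = 𝟙 (up? Z ⊎-dec down? Z)
    by-cases : (s? : Dec (Shared Z)) → Dec (1 ≤ multiplicity Z) →
      multiplicity Z + 𝟙 s? + e ≤ d * 𝟙 s? + 1
    by-cases (yes _) (yes Z-member) = begin
      multiplicity Z + 1 + e ≡⟨ cong (multiplicity Z + 1 +_) (𝟙-no (up? Z ⊎-dec down? Z) (member⇒¬Up⊎Down Z-member)) ⟩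
      multiplicity Z + 1 + 0 ≡⟨ +-identityʳ _ ⟩
      multiplicity Z + 1     ≤⟨ +-monoˡ-≤ 1 (multiplicity≤d Z) ⟩
      d + 1                  ≡⟨ cong (_+ 1) (*-identityʳ d) ⟨
      d * 1 + 1              ∎
    by-cases (yes Z-shared) (no Z-nonmember) = contradiction (shared⇒member Z-shared) Z-nonmember
    by-cases (no Z-unshared) (yes Z-member) = begin
      multiplicity Z + 0 + e ≡⟨ cong (multiplicity Z + 0 +_) (𝟙-no (up? Z ⊎-dec down? Z) (member⇒¬Up⊎Down Z-member)) ⟩
      multiplicity Z + 0 + 0 ≡⟨ trans (+-identityʳ _) (+-identityʳ _) ⟩
      multiplicity Z         ≤⟨ s≤s⁻¹ (≰⇒> Z-unshared) ⟩
      1                      ≡⟨ cong (_+ 1) (*-zeroʳ d) ⟨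
      d * 0 + 1              ∎
    by-cases (no _) (no Z-nonmember) = begin
      multiplicity Z + 0 + e ≡⟨ cong (λ m → m + 0 + e) (n<1⇒n≡0 (≰⇒> Z-nonmember)) ⟩
      e                      ≤⟨ 𝟙≤1 (up? Z ⊎-dec down? Z) ⟩
      1                      ≡⟨ cong (_+ 1) (*-zeroʳ d) ⟨
      d * 0 + 1              ∎

  ∣Shared∣ ∣Up∣ ∣Down∣ ∣Up∩Down∣ ∣Up∪Down∣ : ℕ
  ∣Shared∣  = ∑ n (λ Z → 𝟙 (shared? Z))
  ∣Up∣      = ∑ n (λ Z → 𝟙 (up? Z))
  ∣Down∣    = ∑ n (λ Z → 𝟙 (down? Z))
  ∣Up∩Down∣ = ∑ n (λ Z → 𝟙 (up? Z ×-dec down? Z))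
  ∣Up∪Down∣ = ∑ n (λ Z → 𝟙 (up? Z ⊎-dec down? Z))

  ∑card≡∑multiplicity : sumFin d (λ i → card (𝓐 i)) ≡ ∑ n multiplicity
  ∑card≡∑multiplicity = trans
    (cong sum (map-cong (λ i → length≡∑-𝟙-∈ n (members (𝓐 i)) (unique (𝓐 i))) (allFin d)))
    (sum-∑-comm n (λ i Z → 𝟙 (Z ∈? members (𝓐 i))) (allFin d))

  ∣Up∪Down∣+∣Up∩Down∣≡∣Up∣+∣Down∣ : ∣Up∪Down∣ + ∣Up∩Down∣ ≡ ∣Up∣ + ∣Down∣
  ∣Up∪Down∣+∣Up∩Down∣≡∣Up∣+∣Down∣ = begin-equality
    ∣Up∪Down∣ + ∣Up∩Down∣
      ≡⟨ ∑-distrib-+ n _ _ ⟨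
    ∑ n (λ Z → 𝟙 (up? Z ⊎-dec down? Z) + 𝟙 (up? Z ×-dec down? Z))
      ≡⟨ ∑-cong n (λ Z → 𝟙-⊎-× (up? Z) (down? Z)) ⟩
    ∑ n (λ Z → 𝟙 (up? Z) + 𝟙 (down? Z))
      ≡⟨ ∑-distrib-+ n _ _ ⟩
    ∣Up∣ + ∣Down∣
      ∎

  2^n*∣Up∩Down∣≤∣Up∣*∣Down∣ : 2 ^ n * ∣Up∩Down∣ ≤ ∣Up∣ * ∣Down∣
  2^n*∣Up∩Down∣≤∣Up∣*∣Down∣ = begin
    2 ^ n * ∣Up∩Down∣
      ≡⟨ cong (2 ^ n *_) (∑-cong n (λ Z → 𝟙-× (up? Z) (down? Z))) ⟩
    2 ^ n * ∑ n (λ Z → 𝟙 (up? Z) * 𝟙 (down? Z))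
      ≤⟨ harris-kleitman n (λ Z⊆W → 𝟙-mono (up? _) (up? _) (Up-mono Z⊆W))
                           (λ Z⊆W → 𝟙-mono (down? _) (down? _) (Down-antimono Z⊆W)) ⟩
    ∣Up∣ * ∣Down∣
      ∎

  2*∣Up∣≤2^n : 2 * ∣Up∣ ≤ 2 ^ n
  2*∣Up∣≤2^n = ≤-trans (∑-antipodal n _ (λ Z → 𝟙-disjoint-≤ (up? Z) (up? (∁ Z)) (¬Up×Up∁ Z)))
                       (≤-reflexive (*-identityʳ (2 ^ n)))

  2*∣Down∣≤2^n : 2 * ∣Down∣ ≤ 2 ^ n
  2*∣Down∣≤2^n = ≤-trans (∑-antipodal n _ (λ Z → 𝟙-disjoint-≤ (down? Z) (down? (∁ Z)) (¬Down×Down∁ Z)))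
                         (≤-reflexive (*-identityʳ (2 ^ n)))

  ∣Shared∣≤∣Up∩Down∣ : ∣Shared∣ ≤ ∣Up∩Down∣
  ∣Shared∣≤∣Up∩Down∣ = begin
    ∣Shared∣
      ≤⟨ ∑-mono-≤ n (λ Y → 𝟙-mono (shared? Y) (up? (∁ Y) ×-dec down? (∁ Y)) shared⇒Up∁×Down∁) ⟩
    ∑ n (λ Y → 𝟙 (up? (∁ Y) ×-dec down? (∁ Y)))
      ≡⟨ ∑-∁ n (λ Z → 𝟙 (up? Z ×-dec down? Z)) ⟩
    ∣Up∩Down∣
      ∎

  2*∣Up∩Down∣≤∣Up∣ : 2 * ∣Up∩Down∣ ≤ ∣Up∣
  2*∣Up∩Down∣≤∣Up∣ = n*c≤u*v∧2*v≤n⇒2*c≤u {{m^n≢0 2 n}} 2^n*∣Up∩Down∣≤∣Up∣*∣Down∣ 2*∣Down∣≤2^n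

  2*∣Up∩Down∣≤∣Down∣ : 2 * ∣Up∩Down∣ ≤ ∣Down∣
  2*∣Up∩Down∣≤∣Down∣ = n*c≤u*v∧2*v≤n⇒2*c≤u {{m^n≢0 2 n}}
    (subst (2 ^ n * ∣Up∩Down∣ ≤_) (*-comm ∣Up∣ ∣Down∣) 2^n*∣Up∩Down∣≤∣Up∣*∣Down∣) 2*∣Up∣≤2^n

  4*∣Shared∣≤2^n : 4 * ∣Shared∣ ≤ 2 ^ n
  4*∣Shared∣≤2^n = begin
    4 * ∣Shared∣        ≤⟨ *-monoʳ-≤ 4 ∣Shared∣≤∣Up∩Down∣ ⟩
    4 * ∣Up∩Down∣       ≡⟨ *-assoc 2 2 ∣Up∩Down∣ ⟩
    2 * (2 * ∣Up∩Down∣) ≤⟨ *-monoʳ-≤ 2 2*∣Up∩Down∣≤∣Up∣ ⟩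
    2 * ∣Up∣            ≤⟨ 2*∣Up∣≤2^n ⟩
    2 ^ n               ∎

  3*∣Shared∣≤∣Up∪Down∣ : 3 * ∣Shared∣ ≤ ∣Up∪Down∣
  3*∣Shared∣≤∣Up∪Down∣ = ≤-trans (*-monoʳ-≤ 3 ∣Shared∣≤∣Up∩Down∣) (+-cancelʳ-≤ ∣Up∩Down∣ _ _ (begin
    3 * ∣Up∩Down∣ + ∣Up∩Down∣     ≡⟨ +-comm (3 * ∣Up∩Down∣) ∣Up∩Down∣ ⟩
    4 * ∣Up∩Down∣                 ≡⟨ *-distribʳ-+ ∣Up∩Down∣ 2 2 ⟩
    2 * ∣Up∩Down∣ + 2 * ∣Up∩Down∣ ≤⟨ +-mono-≤ 2*∣Up∩Down∣≤∣Up∣ 2*∣Up∩Down∣≤∣Down∣ ⟩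
    ∣Up∣ + ∣Down∣                 ≡⟨ ∣Up∪Down∣+∣Up∩Down∣≡∣Up∣+∣Down∣ ⟨
    ∣Up∪Down∣ + ∣Up∩Down∣         ∎))

  ∣Shared∣≤2^[n∸2] : ∣Shared∣ ≤ 2 ^ (n ∸ 2)
  ∣Shared∣≤2^[n∸2] = *-cancelˡ-≤ 4 (≤-trans 4*∣Shared∣≤2^n (2^n≤4*2^[n∸2] n))

  ∑multiplicity+4*∣Shared∣≤d*∣Shared∣+2^n : ∑ n multiplicity + 4 * ∣Shared∣ ≤ d * ∣Shared∣ + 2 ^ n
  ∑multiplicity+4*∣Shared∣≤d*∣Shared∣+2^n = begin
    ∑ n multiplicity + 4 * ∣Shared∣
      ≡⟨ +-assoc (∑ n multiplicity) ∣Shared∣ (3 * ∣Shared∣) ⟨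
    ∑ n multiplicity + ∣Shared∣ + 3 * ∣Shared∣
      ≤⟨ +-monoʳ-≤ (∑ n multiplicity + ∣Shared∣) 3*∣Shared∣≤∣Up∪Down∣ ⟩
    ∑ n multiplicity + ∣Shared∣ + ∣Up∪Down∣
      ≡⟨ trans (∑-distrib-+ n _ _) (cong (_+ ∣Up∪Down∣) (∑-distrib-+ n _ _)) ⟨
    ∑ n (λ Z → multiplicity Z + 𝟙 (shared? Z) + 𝟙 (up? Z ⊎-dec down? Z))
      ≤⟨ ∑-mono-≤ n pointwise-bound ⟩
    ∑ n (λ Z → d * 𝟙 (shared? Z) + 1)
      ≡⟨ trans (∑-distrib-+ n _ _) (cong₂ _+_ (∑-distribˡ-* n d _) (trans (∑-const n 1) (*-identityʳ (2 ^ n)))) ⟩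
    d * ∣Shared∣ + 2 ^ n
      ∎

-- The bound also holds for n = 0 and for d = 0.
theorem10 : (n d : ℕ) → 1 ≤ n → 1 ≤ d → (𝓐 : Fin d → Family n) →
    (∀ i j → ¬ (i ≡ j) → CrossIU (𝓐 i) (𝓐 j)) →
    sumFin d (λ i → card (𝓐 i)) ≤ (2 ^ n) ⊔ (d * 2 ^ (n ∸ 2))
theorem10 n d _ _ 𝓐 cross = begin
  sumFin d (λ i → card (𝓐 i))  ≡⟨ ∑card≡∑multiplicity ⟩
  ∑ n multiplicity              ≤⟨ t+k*i≤d*i+n⇒t≤n⊔d*q 4 d ∑multiplicity+4*∣Shared∣≤d*∣Shared∣+2^n
                                                          ∣Shared∣≤2^[n∸2] (2^n≤4*2^[n∸2] n) ⟩
  2 ^ n ⊔ d * 2 ^ (n ∸ 2)       ∎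
  where
  open CrossIUFamilies 𝓐 cross
  open ≤-Reasoning
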